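{- Let $k\ge1$. For $1\le s\le k$ and $m,j\ge1$: (1) if $\mathcal{BF}_k(k(m-1)+s,j)$ is nonempty then $m\ge j$; (2) if $\mathcal{BF}_k(k(m-1)+s,\overline j)$ is nonempty then $s=k$ and $m\ge j$.
   Context: Overpartitions here are non-increasing sequences of positive integers in which the first occurrence of each distinct part value may be overlined (among equal sizes the overlined part comes first); a part $t$ or $\overline t$ has size $t$, written $|\cdot|=t$. An $F_k$-overpartition is such an overpartition $\pi=(\pi_1,\ldots,\pi_\ell)$ with the property that whenever $\pi_i$ is overlined, $\ell-i\equiv-1\pmod k$. For $m\ge1$, $\mathcal{BF}_k(m)$ is the set of $F_k$-overpartitions $\lambda=(\lambda_1,\ldots,\lambda_m)$ with exactly $m$ parts such that (i) if $k=1$ then $\lambda_m=\overline1$ or $1$, and if $k\ge2$ then $\lambda_m=1$; (ii) for $1\le i<m$, $|\lambda_i|\le|\lambda_{i+1}|+1$, with strict inequality if $\lambda_{i+1}$ is non-overlined. For $m,j\ge1$, $\mathcal{BF}_k(m,j)$ (resp. $\mathcal{BF}_k(m,\overline j)$) is the set of overpartitions in $\mathcal{BF}_k(m)$ whose largest part is $j$ (resp. $\overline j$). -}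

module Defs where

open import Data.Nat using (ℕ; zero; suc; _+_; _*_; _∸_; _≤_; _<_)
open import Data.Nat.Divisibility using (_∣_)
open import Data.Bool using (Bool; true; false)
open import Data.List using (List; []; _∷_; length; head; last)
open import Data.List.Relation.Unary.All using (All)
open import Data.List.Relation.Unary.Linked using (Linked)
open import Data.Maybe using (Maybe; just; nothing)
open import Data.Product using (_×_)
open import Data.Unit using (⊤)
open import Relation.Binary.PropositionalEquality using (_≡_)

record Part : Set where
  constructor part
  field
    size : ℕ
    over : Bool
open Part public

-- Condition on consecutive parts (πᵢ , πᵢ₊₁) of an overpartition:
-- sizes non-increasing, and an overlined part is the first among
-- parts of equal size (so at most one overlined part per size).
OverStep : Part → Part → Set
OverStep p q = (size q ≤ size p) × (over q ≡ true → size q < size p)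

IsOverpartition : List Part → Set
IsOverpartition π = All (λ p → 1 ≤ size p) π × Linked OverStep π

-- F_k condition: if πᵢ is overlined then ℓ - i ≡ -1 (mod k),
-- i.e. k divides ℓ - i + 1 = number of parts from position i to the end.
FkCond : ℕ → List Part → Set
FkCond k [] = ⊤
FkCond k (p ∷ ps) = (over p ≡ true → k ∣ suc (length ps)) × FkCond k ps

IsFkOverpartition : ℕ → List Part → Set
IsFkOverpartition k π = IsOverpartition π × FkCond k π

LastCond : ℕ → List Part → Set
LastCond 1 λ' = Data.Maybe.map size (last λ') ≡ just 1
LastCond k λ' = last λ' ≡ just (part 1 false)

BFStep : Part → Part → Set
BFStep p q = (size p ≤ size q + 1) × (over q ≡ false → size p < size q + 1)

BF : ℕ → ℕ → List Part → Set
BF k m λ' = IsFkOverpartition k λ' × (length λ' ≡ m) × LastCond k λ' × Linked BFStep λ'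

BFj : ℕ → ℕ → ℕ → List Part → Set
BFj k m j λ' = BF k m λ' × (head λ' ≡ just (part j false))

BFjbar : ℕ → ℕ → ℕ → List Part → Set
BFjbar k m j λ' = BF k m λ' × (head λ' ≡ just (part j true))

{-# OPTIONS --safe #-}
module Submission where

-- Read from the last part (of size 1) upwards, the part sizes of a BF_k-overpartition can grow
-- by one only across an overlined part, and an overlined part occurs only where the number of
-- parts from it to the end is a multiple of k.  Hence the first part of a BF_k-overpartition
-- with ℓ parts has size at most ⌈ℓ/k⌉, i.e. k·|λ₁| < ℓ + k, and ℓ = k(m−1)+s ≤ km gives j ≤ m.
-- An overlined first part moreover forces k ∣ ℓ, so k ∣ s and s = k.

open import Defs
open import Data.Nat using (ℕ; suc; _+_; _*_; _∸_; _≤_; _<_)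
open import Data.Nat.Properties
open import Data.Nat.Divisibility using (_∣_; divides; ∣⇒≤; ∣m+n∣m⇒∣n; m∣m*n)
open import Data.Bool using (true; false)
open import Data.List using (List; []; _∷_; length; last)
open import Data.List.Relation.Unary.Linked using (Linked; _∷_)
open import Data.Maybe using (just; map)
open import Data.Maybe.Properties using (just-injective)
open import Data.Product using (_×_; _,_)
open import Relation.Binary.PropositionalEquality using (_≡_; refl; cong; sym; trans; subst)

-- n + k is a multiple of k exceeding k * a, so it is at least the next multiple k * (a + 1).
∣⇒*-suc-≤ : ∀ {k n} a → k ∣ n → k * a < n + k → k * suc a ≤ n + k
∣⇒*-suc-≤ {k} a (divides t refl) k*a<n+k = begin
    k * suc a ≤⟨ *-monoʳ-≤ k (*-cancelˡ-< k a (suc t) k*a<k*[1+t]) ⟩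
    k * suc t ≡⟨ sym n+k≡k*[1+t] ⟩
    t * k + k ∎
  where
  open ≤-Reasoning
  n+k≡k*[1+t] : t * k + k ≡ k * suc t
  n+k≡k*[1+t] = trans (+-comm (t * k) k) (*-comm (suc t) k)
  k*a<k*[1+t] : k * a < k * suc t
  k*a<k*[1+t] = subst (k * a <_) n+k≡k*[1+t] k*a<n+k

k*[m∸1]+s≤k*m : ∀ {k m s} → 1 ≤ m → s ≤ k → k * (m ∸ 1) + s ≤ k * m
k*[m∸1]+s≤k*m {k} {suc m} {s} _ s≤k = begin
    k * m + s ≤⟨ +-monoʳ-≤ (k * m) s≤k ⟩
    k * m + k ≡⟨ +-comm (k * m) k ⟩
    k + k * m ≡⟨ sym (*-suc k m) ⟩
    k * suc m ∎
  where open ≤-Reasoning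

k*j<k*m+k⇒j≤m : ∀ k {j m} → k * j < k * m + k → j ≤ m
k*j<k*m+k⇒j≤m k {j} {m} k*j<k*m+k = m<1+n⇒m≤n (*-cancelˡ-< k j (suc m) k*j<k*[1+m])
  where
  k*j<k*[1+m] : k * j < k * suc m
  k*j<k*[1+m] = subst (k * j <_) (trans (+-comm (k * m) k) (sym (*-suc k m))) k*j<k*m+k

∣∧≤⇒≡ : ∀ {k s} → 1 ≤ s → s ≤ k → k ∣ s → s ≡ k
∣∧≤⇒≡ {s = suc _} _ s≤k k∣s = ≤-antisym s≤k (∣⇒≤ k∣s)

LastCond⇒last-size≡1 : ∀ k xs → LastCond k xs → map size (last xs) ≡ just 1
LastCond⇒last-size≡1 0 xs last≡1 = cong (map size) last≡1
LastCond⇒last-size≡1 1 xs last≡1 = last≡1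
LastCond⇒last-size≡1 (suc (suc k)) xs last≡1 = cong (map size) last≡1

k*head<length+k : ∀ k p xs → FkCond k (p ∷ xs) → Linked BFStep (p ∷ xs) →
                  map size (last (p ∷ xs)) ≡ just 1 → k * size p < length (p ∷ xs) + k
k*head<length+k k p [] _ _ last≡1 rewrite just-injective last≡1 | *-identityʳ k = n<1+n k
k*head<length+k k p (part a false ∷ rest) (_ , fk) ((_ , p<a+1) ∷ linked) last≡1 = begin-strict
    k * size p ≤⟨ *-monoʳ-≤ k (m<1+n⇒m≤n (subst (size p <_) (+-comm a 1) (p<a+1 refl))) ⟩
    k * a <⟨ k*head<length+k k (part a false) rest fk linked last≡1 ⟩
    length (part a false ∷ rest) + k ≤⟨ n≤1+n _ ⟩
    length (p ∷ part a false ∷ rest) + k ∎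
  where open ≤-Reasoning
k*head<length+k k p (part a true ∷ rest) (_ , fk@(k∣n , _)) ((p≤a+1 , _) ∷ linked) last≡1 = begin-strict
    k * size p ≤⟨ *-monoʳ-≤ k (subst (size p ≤_) (+-comm a 1) p≤a+1) ⟩
    k * suc a ≤⟨ ∣⇒*-suc-≤ a (k∣n refl) (k*head<length+k k (part a true) rest fk linked last≡1) ⟩
    length (part a true ∷ rest) + k <⟨ n<1+n _ ⟩
    length (p ∷ part a true ∷ rest) + k ∎
  where open ≤-Reasoning

BF⇒k*head<m+k : ∀ {k m p xs} → BF k m (p ∷ xs) → k * size p < m + k
BF⇒k*head<m+k {k} {p = p} {xs} ((_ , fk) , refl , lc , linked) =
  k*head<length+k k p xs fk linked (LastCond⇒last-size≡1 k (p ∷ xs) lc)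

BF⇒overlined-head⇒∣ : ∀ {k m p xs} → BF k m (p ∷ xs) → over p ≡ true → k ∣ m
BF⇒overlined-head⇒∣ ((_ , (k∣m , _)) , refl , _) p-over = k∣m p-over

proposition3p11 : (k : ℕ) → 1 ≤ k → (s m j : ℕ) → 1 ≤ s → s ≤ k → 1 ≤ m → 1 ≤ j →
    ((λ' : List Part) → BFj k (k * (m ∸ 1) + s) j λ' → j ≤ m)
    × ((λ' : List Part) → BFjbar k (k * (m ∸ 1) + s) j λ' → (s ≡ k) × (j ≤ m))
proposition3p11 k _ s m j 1≤s s≤k 1≤m _ = non-overlined , overlined
  where
  head≤m : ∀ {p xs} → BF k (k * (m ∸ 1) + s) (p ∷ xs) → size p ≤ m
  head≤m bf = k*j<k*m+k⇒j≤m k (<-≤-trans (BF⇒k*head<m+k bf) (+-monoˡ-≤ k (k*[m∸1]+s≤k*m 1≤m s≤k)))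

  non-overlined : (λ' : List Part) → BFj k (k * (m ∸ 1) + s) j λ' → j ≤ m
  non-overlined [] (_ , ())
  non-overlined (p ∷ xs) (bf , refl) = head≤m bf

  overlined : (λ' : List Part) → BFjbar k (k * (m ∸ 1) + s) j λ' → (s ≡ k) × (j ≤ m)
  overlined [] (_ , ())
  overlined (p ∷ xs) (bf , refl) =
    ∣∧≤⇒≡ 1≤s s≤k (∣m+n∣m⇒∣n (BF⇒overlined-head⇒∣ bf refl) (m∣m*n (m ∸ 1))) , head≤m bf
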